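{- Let $\tau:$ SYNCSIMPLE $\to$ LOCKSIMPLE$_{2,IS}$ be a correct translation of blocking type $(P_1P_1,P_2P_2)$. Then the following holds: (1) The blocking prefix of $\tau(!)$ is $R_1P_1\{P_2,T_2\}^*T_2P_1$ and the blocking prefix of $\tau(?)$ is $R_3P_2\{P_1,T_1\}^*T_1P_2$. (2) $\{T_1,P_1\}^*T_2$ is a prefix of $\tau(!)$, and $\{T_2,P_2\}^*T_1$ is a prefix of $\tau(?)$.
   Context: SYNCSIMPLE: subprocesses $U ::= \checkmark \mid 0 \mid\ !U \mid\ ?U$; processes are parallel compositions (multisets) of subprocesses; reduction $!U_1 \mid ?U_2 \mid P \to U_1 \mid U_2 \mid P$; successful = has a parallel component $\checkmark$; may-convergent = reduces to a successful process; must-convergent = every reduct is may-convergent. LOCKSIMPLE$_{2,IS}$: two locks, each full ($\blacksquare$) or empty ($\Box$), initial store $IS$; subprocesses $U ::= 0 \mid \checkmark \mid P_iU \mid T_iU$ ($i\in\{1,2\}$); $P_i$ on empty lock $i$ fills it, on a full lock blocks; $T_i$ never blocks and empties lock $i$. Convergence evaluated from $(P,IS)$. $\tau$ is compositional ($\tau(0)=0$, $\tau(\checkmark)=\checkmark$, $\tau$ commutes with parallel composition, $\tau(!U)=\tau(!)\tau(U)$, $\tau(?U)=\tau(?)\tau(U)$); correct = preserve and reflect may- and must-convergence. Blocking types of a sequence $S$ executed alone from $IS$: type $P_iP_i$ if $S$ has a (blocking) prefix $R_1P_iR_2P_i$ with $R_2$ free of $P_i,T_i$ and execution deadlocks exactly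 before the last $P_i$; type $P_i$ if $S$ has a (blocking) prefix $R_1P_i$ with $R_1$ free of $P_i,T_i$ and execution deadlocks exactly before this $P_i$. $\tau$ has blocking type $(W_1,W_2)$ if $W_1$ is the type of $\tau(!)$, $W_2$ that of $\tau(?)$. Notation: $\{A,B\}^*$ denotes arbitrary finite strings over $A,B$, concatenated with the following symbols. -}

module Defs where

open import Data.Bool using (Bool; true; false)
open import Data.Product using (Σ; ∃; ∃-syntax; _×_; _,_)
open import Data.Maybe using (Maybe; just; nothing)
open import Data.List using (List; []; _∷_; _++_; map)
open import Data.List.Relation.Unary.All using (All)
open import Data.List.Membership.Propositional using (_∈_)
open import Data.List.Relation.Binary.Permutation.Propositional using (_↭_)
open import Relation.Binary.PropositionalEquality using (_≡_)
open import Relation.Binary.Construct.Closure.ReflexiveTransitive using (Star)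
open import Function.Bundles using (_⇔_)

data SU : Set where
  ✓  : SU
  𝟘  : SU
  !_ : SU → SU
  ¿_ : SU → SU          -- the prefix "?" of the paper

-- processes: parallel compositions (multisets, represented as lists
-- taken up to permutation in the reduction relation)
SProc : Set
SProc = List SU

data _⟶S_ : SProc → SProc → Set where
  sync : ∀ {P Q U₁ U₂} → P ↭ ((! U₁) ∷ (¿ U₂) ∷ Q) → P ⟶S (U₁ ∷ U₂ ∷ Q)

SuccessfulS : SProc → Set
SuccessfulS P = ✓ ∈ P

MayS : SProc → Set
MayS P = ∃[ P' ] (Star _⟶S_ P P' × SuccessfulS P')

MustS : SProc → Set
MustS P = ∀ P' → Star _⟶S_ P P' → MayS P'

data Lock : Set where
  l₁ l₂ : Lock

data Act : Set where
  P : Lock → Act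
  T : Lock → Act

-- a store: contents of lock 1 and lock 2; true = full (■), false = empty (□)
Store : Set
Store = Bool × Bool

get : Store → Lock → Bool
get (a , b) l₁ = a
get (a , b) l₂ = b

set : Store → Lock → Bool → Store
set (a , b) l₁ v = (v , b)
set (a , b) l₂ v = (a , v)

-- one action on the store; nothing = blocked
step : Store → Act → Maybe Store
step s (P i) with get s i
... | true  = nothing
... | false = just (set s i true)
step s (T i) = just (set s i false)

data LU : Set where
  𝟘  : LU
  ✓  : LU
  _∙_ : Act → LU → LU

infixr 5 _∙_

LProc : Set
LProc = List LU

Config : Set
Config = LProc × Store

data _⟶L_ : Config → Config → Set where
  act : ∀ {Ps Q a U s s'} → Ps ↭ ((a ∙ U) ∷ Q) → step s a ≡ just s' →
        (Ps , s) ⟶L (U ∷ Q , s')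

SuccessfulL : Config → Set
SuccessfulL (Ps , s) = ✓ ∈ Ps

MayL : Config → Set
MayL c = ∃[ c' ] (Star _⟶L_ c c' × SuccessfulL c')

MustL : Config → Set
MustL c = ∀ c' → Star _⟶L_ c c' → MayL c'

-- compositional translations: determined by τ(!) and τ(?)

record Translation : Set where
  field
    τ! : List Act
    τ? : List Act
open Translation public

prefixL : List Act → LU → LU
prefixL []       U = U
prefixL (a ∷ as) U = a ∙ prefixL as U

τU : Translation → SU → LU
τU τ ✓       = ✓
τU τ 𝟘       = 𝟘
τU τ (! U)   = prefixL (τ! τ) (τU τ U)
τU τ (¿ U)   = prefixL (τ? τ) (τU τ U)

τP : Translation → SProc → LProc
τP τ = map (τU τ)

Correct : Store → Translation → Set
Correct IS τ = ∀ (Q : SProc) →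
  (MayS Q ⇔ MayL (τP τ Q , IS)) × (MustS Q ⇔ MustL (τP τ Q , IS))

run : Store → List Act → Maybe Store
run s []       = just s
run s (a ∷ as) with step s a
... | nothing = nothing
... | just s' = run s' as

BlockedBefore : Store → List Act → Lock → Set
BlockedBefore IS pre i = ∃[ s ] (run IS pre ≡ just s × get s i ≡ true)

data OnLock (j : Lock) : Act → Set where
  isP : OnLock j (P j)
  isT : OnLock j (T j)

other : Lock → Lock
other l₁ = l₂
other l₂ = l₁

-- an action free of P_i and T_i (with two locks: an action on the other lock)
Free : Lock → Act → Set
Free i a = OnLock (other i) a

TypePP : Store → List Act → Lock → Set
TypePP IS S i = ∃[ R₁ ] ∃[ R₂ ] ∃[ R ]
  ( S ≡ R₁ ++ P i ∷ R₂ ++ P i ∷ R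
  × All (Free i) R₂
  × BlockedBefore IS (R₁ ++ P i ∷ R₂) i )

IsBlockingPrefix : Store → List Act → List Act → Set
IsBlockingPrefix IS S B = ∃[ pre ] ∃[ i ] ∃[ R ]
  ( S ≡ pre ++ P i ∷ R
  × B ≡ pre ++ P i ∷ []
  × BlockedBefore IS pre i )

-- Both parts use only the must-convergent processes !✓ | ?0 and !0 | ?✓: from their
-- translations no configuration in which both threads are blocked may be reachable.
-- For (2), run τ(?) alone up to its blocking P₂; lock 2 is then full and τ(?) waits
-- on it. If τ(!) reached P₂, or blocked (it must, having type P₁P₁), while touching
-- only lock 1, both threads would be stuck. For (1), run τ(!) up to its first P₁ and
-- then τ(?) until it blocks on a full lock; this must be lock 2 with lock 1 empty,
-- else both are stuck. Now τ(!) fills lock 1 and runs the segment between its two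
-- P₁, which touches only lock 2 while τ(?) waits on P₂; unless the segment ends with
-- T₂, τ(!) reaches its second P₁ with both locks full.
module Submission where

open import Defs
open import Data.Product using (∃-syntax; _×_)
open import Data.List using (List; []; _∷_; _++_)
open import Data.List.Relation.Unary.All using (All)
open import Relation.Binary.PropositionalEquality using (_≡_)

open import Data.Bool using (true; false)
open import Data.Maybe using (just; nothing)
open import Data.Product using (_,_; proj₂)
open import Data.Sum using (_⊎_; inj₁; inj₂)
open import Data.Empty using (⊥-elim)
open import Data.List using (_∷ʳ_; initLast; _∷ʳ′_)
open import Data.List.Properties using (++-assoc; ∷-injective)
open import Data.List.Relation.Unary.All using ([]; _∷_)
open import Data.List.Relation.Unary.All.Properties using (∷ʳ⁻)
open import Data.List.Relation.Unary.Any using (here; there)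
open import Data.List.Relation.Unary.First using (first) renaming (_++_∷_ to split-at-first)
open import Data.List.Relation.Unary.First.Properties using (toView)
open import Data.List.Membership.Propositional using (_∈_)
open import Data.List.Membership.Propositional.Properties using (∈-++⁺ˡ)
open import Data.List.Relation.Binary.Permutation.Propositional
  using (_↭_; ↭-refl; ↭-sym; ↭-trans; ↭-swap)
open import Data.List.Relation.Binary.Permutation.Propositional.Properties using (∈-resp-↭)
open import Relation.Binary.PropositionalEquality using (refl; sym; trans; cong; subst)
open import Relation.Binary.Construct.Closure.ReflexiveTransitive using (Star; ε; _◅_)
open import Relation.Nullary using (¬_)
open import Function.Bundles using (Equivalence)

private
  variable
    i k : Lock
    a b : Act
    s s′ : Store
    xs ys : List Act
    U V : LU
    Ps Qs : LProc

onLock-dichotomy : ∀ i a → OnLock (other i) a ⊎ OnLock i a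
onLock-dichotomy l₁ (P l₁) = inj₂ isP
onLock-dichotomy l₁ (P l₂) = inj₁ isP
onLock-dichotomy l₁ (T l₁) = inj₂ isT
onLock-dichotomy l₁ (T l₂) = inj₁ isT
onLock-dichotomy l₂ (P l₁) = inj₁ isP
onLock-dichotomy l₂ (P l₂) = inj₂ isP
onLock-dichotomy l₂ (T l₁) = inj₁ isT
onLock-dichotomy l₂ (T l₂) = inj₂ isT

get-set-≡ : ∀ s i v → get (set s i v) i ≡ v
get-set-≡ (_ , _) l₁ v = refl
get-set-≡ (_ , _) l₂ v = refl

get-set-other : ∀ s i v → get (set s (other i) v) i ≡ get s i
get-set-other (_ , _) l₁ v = refl
get-set-other (_ , _) l₂ v = refl

get-other-set : ∀ s i v → get (set s i v) (other i) ≡ get s (other i)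
get-other-set (_ , _) l₁ v = refl
get-other-set (_ , _) l₂ v = refl

step-P-full : get s i ≡ true → step s (P i) ≡ nothing
step-P-full full rewrite full = refl

step-P-empty : get s i ≡ false → step s (P i) ≡ just (set s i true)
step-P-empty empty rewrite empty = refl

step-blocked : step s a ≡ nothing → ∃[ i ] (a ≡ P i × get s i ≡ true)
step-blocked {s} {P i} blocked with get s i in full
... | true = i , refl , full

step-preserves : OnLock (other i) a → step s a ≡ just s′ → get s′ i ≡ get s i
step-preserves {i} {s = s} isP e with get s (other i)
step-preserves {i} {s = s} isP refl | false = get-set-other s i true
step-preserves {i} {s = s} isT refl = get-set-other s i false

run-++ : ∀ s xs → run s (xs ++ ys) ≡ just s′ →
  ∃[ s₁ ] (run s xs ≡ just s₁ × run s₁ ys ≡ just s′)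
run-++ s [] e = s , refl , e
run-++ s (a ∷ xs) e with step s a
... | just s₁ = run-++ s₁ xs e

run-preserves : All (OnLock (other i)) xs → run s xs ≡ just s′ → get s′ i ≡ get s i
run-preserves [] refl = refl
run-preserves {s = s} (_∷_ {a} pa pxs) e with step s a in e₁
... | just s₁ = trans (run-preserves pxs e) (step-preserves pa e₁)

run-∷ʳ-P : ∀ s xs → run s (xs ∷ʳ P i) ≡ just s′ → get s′ i ≡ true
run-∷ʳ-P {i} s [] e with get s i
run-∷ʳ-P {i} s [] refl | false = get-set-≡ s i true
run-∷ʳ-P s (a ∷ xs) e with step s a
... | just s₁ = run-∷ʳ-P s₁ xs e

run-∷-blocked : step s a ≡ nothing → run s (a ∷ xs) ≡ nothing
run-∷-blocked blocked rewrite blocked = refl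

NeverTerminates : List Act → Set
NeverTerminates S = ∀ s → run s S ≡ nothing

run-blocks-at-full-P : get s i ≡ true → All (OnLock (other i)) xs → run s (xs ++ P i ∷ ys) ≡ nothing
run-blocks-at-full-P full [] rewrite full = refl
run-blocks-at-full-P {s = s} full (_∷_ {a} pa pxs) with step s a in e
... | nothing = refl
... | just s₁ = run-blocks-at-full-P (trans (step-preserves pa e) full) pxs

typePP-neverTerminates : ∀ {IS S} → TypePP IS S i → NeverTerminates S
typePP-neverTerminates {i} (R₁ , R₂ , R , refl , pR₂ , _) = go R₁
  where
  go : ∀ R₁ s → run s (R₁ ++ P i ∷ R₂ ++ P i ∷ R) ≡ nothing
  go [] s with get s i
  ... | true  = refl
  ... | false = run-blocks-at-full-P (get-set-≡ s i true) pR₂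
  go (a ∷ R₁) s with step s a
  ... | nothing = refl
  ... | just s₁ = go R₁ s₁

blocking-point-unique : ∀ s u v {r r′ sᵤ sᵥ} → u ++ a ∷ r ≡ v ++ b ∷ r′ →
  run s u ≡ just sᵤ → step sᵤ a ≡ nothing → run s v ≡ just sᵥ → step sᵥ b ≡ nothing →
  u ≡ v × a ≡ b
blocking-point-unique s [] [] refl refl _ refl _ = refl , refl
blocking-point-unique s [] (c ∷ v) refl refl blocked ev _
  with () ← trans (sym (run-∷-blocked {s} {c} {v} blocked)) ev
blocking-point-unique s (c ∷ u) [] refl eu _ refl blocked
  with () ← trans (sym (run-∷-blocked {s} {c} {u} blocked)) eu
blocking-point-unique s (c ∷ u) (c′ ∷ v) eq eu ba ev bb with ∷-injective eq
... | refl , eq′ with step s c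
...   | just s₁ with blocking-point-unique s₁ u v eq′ eu ba ev bb
...     | refl , refl = refl , refl

prefixL-++ : ∀ xs ys U → prefixL (xs ++ ys) U ≡ prefixL xs (prefixL ys U)
prefixL-++ []       ys U = refl
prefixL-++ (a ∷ xs) ys U = cong (a ∙_) (prefixL-++ xs ys U)

mustL-split : ∀ xs ys → MustL (prefixL (xs ++ ys) U ∷ Qs , s) →
  MustL (prefixL xs (prefixL ys U) ∷ Qs , s)
mustL-split xs ys = subst (λ W → MustL (W ∷ _ , _)) (prefixL-++ xs ys _)

⟶L-resp-↭ : Ps ↭ Qs → ∀ {c} → (Qs , s) ⟶L c → (Ps , s) ⟶L c
⟶L-resp-↭ PQ (act p e) = act (↭-trans PQ p) e

mustL-resp-↭ : Ps ↭ Qs → MustL (Ps , s) → MustL (Qs , s)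
mustL-resp-↭ PQ must c (r ◅ rs) = must c (⟶L-resp-↭ PQ r ◅ rs)
mustL-resp-↭ PQ must _ ε with must _ ε
... | _ , ε , ok      = _ , ε , ∈-resp-↭ PQ ok
... | c , r ◅ rs , ok = c , ⟶L-resp-↭ (↭-sym PQ) r ◅ rs , ok

mustL-swap : MustL (U ∷ V ∷ [] , s) → MustL (V ∷ U ∷ [] , s)
mustL-swap = mustL-resp-↭ (↭-swap _ _ ↭-refl)

mustL-step : MustL ((a ∙ U) ∷ Qs , s) → step s a ≡ just s′ → MustL (U ∷ Qs , s′)
mustL-step must e c r = must c (act ↭-refl e ◅ r)

mustL-run : ∀ xs → MustL (prefixL xs U ∷ Qs , s) → run s xs ≡ just s′ → MustL (U ∷ Qs , s′)
mustL-run []       must refl = must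
mustL-run {s = s} (a ∷ xs) must e with step s a in e₁
... | just s₁ = mustL-run xs (mustL-step must e₁) e

deadlock : step s a ≡ nothing → step s b ≡ nothing → ¬ MustL ((a ∙ U) ∷ (b ∙ V) ∷ [] , s)
deadlock ba bb must with must _ ε
... | _ , ε , there (here ())
... | _ , ε , there (there ())
... | _ , act p e ◅ _ , _ with ∈-resp-↭ (↭-sym p) (here refl)
...   | here refl         with () ← trans (sym ba) e
...   | there (here refl) with () ← trans (sym bb) e

run-until-blocked : ∀ xs → MustL (prefixL xs U ∷ Qs , s) → run s xs ≡ nothing →
  ∃[ i ] ∃[ U′ ] ∃[ s′ ] (get s′ i ≡ true × MustL ((P i ∙ U′) ∷ Qs , s′))
run-until-blocked {s = s} (a ∷ xs) must stuck with step s a in e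
... | just s₁ = run-until-blocked xs (mustL-step must e) stuck
... | nothing with step-blocked {s} {a} e
...   | i , refl , full = i , _ , s , full , must

run-other-lock-beside-waiter : ∀ xs → All (OnLock (other k)) xs → get s k ≡ true →
  MustL (prefixL xs U ∷ (P k ∙ V) ∷ [] , s) →
  ∃[ s′ ] (run s xs ≡ just s′ × get s′ k ≡ true × MustL (U ∷ (P k ∙ V) ∷ [] , s′))
run-other-lock-beside-waiter []       []         full must = _ , refl , full , must
run-other-lock-beside-waiter {s = s} (a ∷ xs) (pa ∷ pxs) full must with step s a in e
... | nothing = ⊥-elim (deadlock e (step-P-full full) must)
... | just s₁ =
  run-other-lock-beside-waiter xs pxs (trans (step-preserves pa e) full) (mustL-step must e)

run-same-lock-beside-waiter : ∀ xs → All (OnLock k) xs →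
  MustL (prefixL xs U ∷ (P k ∙ V) ∷ [] , s) →
  ∃[ s′ ] (run s xs ≡ just s′ × MustL (U ∷ (P k ∙ V) ∷ [] , s′))
run-same-lock-beside-waiter []       []         must = _ , refl , must
run-same-lock-beside-waiter {s = s} (a ∷ xs) (pa ∷ pxs) must with step s a in e
... | just s₁ = run-same-lock-beside-waiter xs pxs (mustL-step must e)
... | nothing with step-blocked {s} {a} e | pa
...   | _ , refl , full | isP = ⊥-elim (deadlock e (step-P-full full) must)

middle-ends-with-T : ∀ R₂ {R} → All (OnLock (other i)) R₂ →
  get s i ≡ true → get s (other i) ≡ true →
  MustL (prefixL (R₂ ++ P i ∷ R) U ∷ (P (other i) ∙ V) ∷ [] , s) →
  ∃[ w ] (All (OnLock (other i)) w × R₂ ≡ w ∷ʳ T (other i))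
middle-ends-with-T {i} {s} R₂ {R} pR₂ fullᵢ fullⱼ must
  with initLast R₂ | run-same-lock-beside-waiter R₂ pR₂ (mustL-split R₂ (P i ∷ R) must)
... | []      | s′ , refl , must′ =
  ⊥-elim (deadlock (step-P-full fullᵢ) (step-P-full fullⱼ) must′)
... | w ∷ʳ′ a | s′ , run′ , must′ with ∷ʳ⁻ pR₂
...   | pw , isT = w , pw , refl
...   | pw , isP = ⊥-elim (deadlock (step-P-full (trans (run-preserves pR₂ run′) fullᵢ))
                                    (step-P-full (run-∷ʳ-P s w run′)) must′)

middle-of-typePP-ends-with-T : ∀ {IS Y} R₁ R₂ {R s₁} → All (OnLock (other i)) R₂ →
  run IS R₁ ≡ just s₁ → run s₁ Y ≡ nothing →
  MustL (prefixL (R₁ ++ P i ∷ R₂ ++ P i ∷ R) ✓ ∷ prefixL Y 𝟘 ∷ [] , IS) →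
  ∃[ w ] (All (OnLock (other i)) w × R₂ ≡ w ∷ʳ T (other i))
middle-of-typePP-ends-with-T {i} {Y = Y} R₁ R₂ {R} pR₂ run₁ stuckY must
  with run-until-blocked Y
         (mustL-swap (mustL-run R₁ (mustL-split R₁ (P i ∷ R₂ ++ P i ∷ R) must) run₁)) stuckY
... | k , _ , s₂ , fullₖ , must₂ with onLock-dichotomy i (P k) | get s₂ i in eᵢ
...   | inj₂ isP | _     = ⊥-elim (deadlock (step-P-full fullₖ) (step-P-full fullₖ) must₂)
...   | inj₁ isP | true  = ⊥-elim (deadlock (step-P-full fullₖ) (step-P-full eᵢ) must₂)
...   | inj₁ isP | false =
  middle-ends-with-T R₂ pR₂ (get-set-≡ s₂ i true) (trans (get-other-set s₂ i true) fullₖ)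
    (mustL-step (mustL-swap must₂) (step-P-empty eᵢ))

blockingPrefix-of-typePP : ∀ {IS X Y} → MustL (prefixL X ✓ ∷ prefixL Y 𝟘 ∷ [] , IS) →
  TypePP IS X i → NeverTerminates Y → ∀ B → IsBlockingPrefix IS X B →
  ∃[ R₁ ] ∃[ w ] (All (OnLock (other i)) w × B ≡ R₁ ++ P i ∷ w ++ T (other i) ∷ P i ∷ [])
blockingPrefix-of-typePP {i} {IS} must (R₁ , R₂ , R , refl , pR₂ , _ , runX , fullX) stuckY _
                         (pre , _ , _ , eqX , refl , _ , runₚ , fullₚ)
  with blocking-point-unique IS pre (R₁ ++ P i ∷ R₂)
         (trans (sym eqX) (sym (++-assoc R₁ (P i ∷ R₂) (P i ∷ R))))
         runₚ (step-P-full fullₚ) runX (step-P-full fullX)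
... | refl , refl with run-++ IS R₁ runX
...   | s₁ , run₁ , _ with middle-of-typePP-ends-with-T R₁ R₂ pR₂ run₁ (stuckY s₁) must
...     | w , pw , refl = R₁ , w , pw ,
  trans (++-assoc R₁ (P i ∷ w ∷ʳ T (other i)) (P i ∷ []))
        (cong (λ z → R₁ ++ P i ∷ z) (++-assoc w (T (other i) ∷ []) (P i ∷ [])))

starts-with-T-beside-waiter : ∀ k X → run s X ≡ nothing → get s k ≡ true →
  MustL (prefixL X U ∷ (P k ∙ V) ∷ [] , s) →
  ∃[ w ] ∃[ R ] (All (OnLock (other k)) w × X ≡ w ++ T k ∷ R)
starts-with-T-beside-waiter k X stuck full must with first (onLock-dichotomy k) X
... | inj₂ pX with _ , done , _ ← run-other-lock-beside-waiter X pX full must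
                   with () ← trans (sym stuck) done
... | inj₁ f with toView f
...   | split-at-first pw isT R = _ , R , pw , refl
...   | split-at-first {w} pw isP R
        with _ , _ , full′ , must′ ←
               run-other-lock-beside-waiter w pw full (mustL-split w (P k ∷ R) must)
           = ⊥-elim (deadlock (step-P-full full′) (step-P-full full′) must′)

starts-with-T : ∀ {IS X Y} k → NeverTerminates X → TypePP IS Y k →
  MustL (prefixL X ✓ ∷ prefixL Y 𝟘 ∷ [] , IS) →
  ∃[ w ] ∃[ R ] (All (OnLock (other k)) w × X ≡ w ++ T k ∷ R)
starts-with-T {IS} {X} k stuckX (R₃ , R₄ , R′ , refl , _ , sY , runY , fullY) must =
  starts-with-T-beside-waiter k X (stuckX sY) fullY (mustL-swap mustY)
  where
  mustY : MustL ((P k ∙ prefixL R′ 𝟘) ∷ prefixL X ✓ ∷ [] , sY)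
  mustY = mustL-run (R₃ ++ P k ∷ R₄)
            (mustL-split (R₃ ++ P k ∷ R₄) (P k ∷ R′)
              (subst (λ Z → MustL (prefixL Z 𝟘 ∷ _ , IS))
                     (sym (++-assoc R₃ (P k ∷ R₄) (P k ∷ R′)))
                (mustL-swap must)))
            runY

✓-preserved : ∀ {Q Q′} → ✓ ∈ Q → Q ⟶S Q′ → ✓ ∈ Q′
✓-preserved ok (sync p) with ∈-resp-↭ p ok
... | there (there ok′) = there (there ok′)

✓-preserved* : ∀ {Q Q′} → ✓ ∈ Q → Star _⟶S_ Q Q′ → ✓ ∈ Q′
✓-preserved* ok ε        = ok
✓-preserved* ok (r ◅ rs) = ✓-preserved* (✓-preserved ok r) rs

sync-pair-inv : ∀ {U₁ U₂ V₁ V₂ Q} → (! U₁ ∷ ¿ U₂ ∷ []) ↭ (! V₁ ∷ ¿ V₂ ∷ Q) →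
  V₁ ≡ U₁ × V₂ ≡ U₂
sync-pair-inv p with ∈-resp-↭ (↭-sym p) (here refl) | ∈-resp-↭ (↭-sym p) (there (here refl))
... | here refl       | there (here refl) = refl , refl
... | there (here ()) | _

mustS-sync-pair : ∀ {U₁ U₂} → ✓ ∈ (U₁ ∷ U₂ ∷ []) → MustS (! U₁ ∷ ¿ U₂ ∷ [])
mustS-sync-pair ok _ ε = _ , sync ↭-refl ◅ ε , ok
mustS-sync-pair ok Q (sync p ◅ rs) with sync-pair-inv p
... | refl , refl = Q , ε , ✓-preserved* (∈-++⁺ˡ ok) rs

lemma5p2 : ∀ (IS : Store) (τ : Translation) → Correct IS τ →
    TypePP IS (τ! τ) l₁ → TypePP IS (τ? τ) l₂ →
    ((∀ B → IsBlockingPrefix IS (τ! τ) B →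
        ∃[ R₁ ] ∃[ w ] (All (OnLock l₂) w × B ≡ R₁ ++ P l₁ ∷ w ++ T l₂ ∷ P l₁ ∷ []))
    × (∀ B → IsBlockingPrefix IS (τ? τ) B →
        ∃[ R₃ ] ∃[ w ] (All (OnLock l₁) w × B ≡ R₃ ++ P l₂ ∷ w ++ T l₁ ∷ P l₂ ∷ [])))
    × ((∃[ w ] ∃[ R ] (All (OnLock l₁) w × τ! τ ≡ w ++ T l₂ ∷ R))
    × (∃[ w ] ∃[ R ] (All (OnLock l₂) w × τ? τ ≡ w ++ T l₁ ∷ R)))
lemma5p2 IS τ correct type! type? =
  (blockingPrefix-of-typePP must! type! stuck? , blockingPrefix-of-typePP must? type? stuck!) ,
  (starts-with-T l₂ stuck! type? must! , starts-with-T l₁ stuck? type! must?)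
  where
  translates-must : ∀ Q → MustS Q → MustL (τP τ Q , IS)
  translates-must Q = Equivalence.to (proj₂ (correct Q))
  must! : MustL (prefixL (τ! τ) ✓ ∷ prefixL (τ? τ) 𝟘 ∷ [] , IS)
  must! = translates-must (! ✓ ∷ ¿ 𝟘 ∷ []) (mustS-sync-pair (here refl))
  must? : MustL (prefixL (τ? τ) ✓ ∷ prefixL (τ! τ) 𝟘 ∷ [] , IS)
  must? = mustL-swap (translates-must (! 𝟘 ∷ ¿ ✓ ∷ []) (mustS-sync-pair (there (here refl))))
  stuck! : NeverTerminates (τ! τ)
  stuck! = typePP-neverTerminates type!
  stuck? : NeverTerminates (τ? τ)
  stuck? = typePP-neverTerminates type?
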